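{- Let $R,S$ be finite digraphs, let $\mathfrak{D}'$ be a class of finite digraphs, and let $\mathcal{E}(R),\mathcal{E}(S)$, $\phi_R,\phi_S$, $\alpha^R,\alpha^S$ be as in the context. Let $\rho$ be an S-scheme from $R$ to $S$ with respect to $\mathfrak{D}'$. (1) If $\rho$ is induced by some strict homomorphism $\epsilon:\mathcal{E}(R)\to\mathcal{E}(S)$, then for all $G,H\in\mathfrak{D}'$, $\xi\in\mathcal{S}(G,R)$, $\zeta\in\mathcal{S}(H,R)$, $v\in V(G)$, $w\in V(H)$: $$\alpha^R_{G,\xi}(v)=\alpha^R_{H,\zeta}(w)\ \Longrightarrow\ \rho_G(\xi)(v)=\rho_H(\zeta)(w).\qquad(\ast)$$ (2) Conversely, if ERD and AID hold and $\rho$ satisfies $(\ast)$, then $\rho$ is induced by the strict homomorphism $\alpha^S_{\mathcal{E}(R),\,\rho_{\mathcal{E}(R)}(\phi_R)}:\mathcal{E}(R)\to\mathcal{E}(S)$.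
   Context: Digraphs $G=(V(G),A(G))$ have a finite nonempty vertex set and $A(G)\subseteq V(G)\times V(G)$; loops are allowed, and $vw$ denotes $(v,w)$. An arc $vw$ is proper if $v\neq w$. A homomorphism $\xi:G\to H$ is a map $V(G)\to V(H)$ with $\xi(v)\xi(w)\in A(H)$ for all $vw\in A(G)$. It is strict if, in addition, it maps every proper arc of $G$ to a proper arc of $H$. $\mathcal{S}(G,H)$ denotes the set of strict homomorphisms from $G$ to $H$. $\mathfrak{D}'$ is a class of finite digraphs taken up to isomorphism: constructed digraphs are identified with their representatives. An S-scheme from $R$ to $S$ with respect to $\mathfrak{D}'$ is a family $\rho=(\rho_G)_{G\in\mathfrak{D}'}$ of maps $\rho_G:\mathcal{S}(G,R)\to\mathcal{S}(G,S)$. Auxiliary data: - $\mathcal{E}(R),\mathcal{E}(S)$ are finite digraphs with vertex sets $\mathcal{E}_o(R),\mathcal{E}_o(S)$. - $\phi_R\in\mathcal{S}(\mathcal{E}(R),R)$ and $\phi_S\in\mathcal{S}(\mathcal{E}(S),S)$. - $\alpha^R$ is an S-scheme from $R$ to $\mathcal{E}(R)$ with respect to $\mathfrak{D}'$, written $\xi\mapsto\alpha^R_{G,\xi}\in\mathcal{S}(G,\mathcal{E}(R))$, such that $\phi_R\circ\alpha^R_{G,\xi}=\xi$ for all $G\in\mathfrak{D}'$ and $\xi\in\mathcal{S}(G,R)$. - $\alpha^S$ is an S-scheme from $S$ to $\mathcal{E}(S)$ with $\phi_S\circ\alpha^S_{G,\zeta}=\zeta$ for all $G\in\mathfrak{D}'$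 and $\zeta\in\mathcal{S}(G,S)$. Given a strict homomorphism $\epsilon:\mathcal{E}(R)\to\mathcal{E}(S)$, the S-scheme induced by $\epsilon$ is $\eta_G(\xi)=\phi_S\circ\epsilon\circ\alpha^R_{G,\xi}$ for $G\in\mathfrak{D}'$ and $\xi\in\mathcal{S}(G,R)$. We say $\rho$ is induced by $\epsilon$ if $\rho_G(\xi)=\eta_G(\xi)$ for all such $G,\xi$. ERD means $\mathcal{E}(R)\in\mathfrak{D}'$. AID means that ERD holds and $\alpha^R_{\mathcal{E}(R),\phi_R}$ is the identity map of $\mathcal{E}_o(R)$. -}

module Defs where

open import Data.Nat using (ℕ; suc)
open import Data.Fin using (Fin)
open import Data.Bool using (Bool; true)
open import Relation.Binary.PropositionalEquality using (_≡_; _≢_)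

-- A finite digraph with nonempty vertex set Fin (suc size); loops allowed.
record Digraph : Set where
  field
    size : ℕ
    arc  : Fin (suc size) → Fin (suc size) → Bool

open Digraph public

V : Digraph → Set
V G = Fin (suc (size G))

Arc : (G : Digraph) → V G → V G → Set
Arc G v w = arc G v w ≡ true

record SHom (G H : Digraph) : Set where
  field
    map    : V G → V H
    hom    : ∀ v w → Arc G v w → Arc H (map v) (map w)
    strict : ∀ v w → v ≢ w → Arc G v w → map v ≢ map w

open SHom public

Class : Set₁
Class = Digraph → Set

SScheme : Class → Digraph → Digraph → Set
SScheme D R S = (G : Digraph) → D G → SHom G R → SHom G S

_∘ₘ_ : ∀ {G H K} → SHom H K → SHom G H → V G → V K
(g ∘ₘ f) v = map g (map f v)

inducedMap : ∀ {D R S ER ES} → SHom ES S → SScheme D R ER → SHom ER ES →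
             (G : Digraph) → D G → SHom G R → V G → V S
inducedMap φS αR ε G d ξ v = map φS (map ε (map (αR G d ξ) v))

-- ρ is induced by ε (equality of strict homomorphisms = equality of vertex maps)
InducedBy : ∀ {D R S ER ES} → SHom ES S → SScheme D R ER → SScheme D R S →
            SHom ER ES → Set
InducedBy {D} {R} φS αR ρ ε =
  ∀ (G : Digraph) (d : D G) (ξ : SHom G R) (v : V G) →
    map (ρ G d ξ) v ≡ inducedMap φS αR ε G d ξ v

Star : ∀ {D R S ER} → SScheme D R ER → SScheme D R S → Set
Star {D} {R} αR ρ =
  ∀ (G H : Digraph) (dG : D G) (dH : D H) (ξ : SHom G R) (ζ : SHom H R)
    (v : V G) (w : V H) →
    map (αR G dG ξ) v ≡ map (αR H dH ζ) w →
    map (ρ G dG ξ) v ≡ map (ρ H dH ζ) w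

IsSection : ∀ {D R ER} → SHom ER R → SScheme D R ER → Set
IsSection {D} {R} φ α =
  ∀ (G : Digraph) (d : D G) (ξ : SHom G R) (v : V G) → map φ (map (α G d ξ) v) ≡ map ξ v

-- AID (given the ERD witness e : D ER)
AID : ∀ {D R ER} → SHom ER R → SScheme D R ER → D ER → Set
AID {ER = ER} φR αR e = ∀ (v : V ER) → map (αR ER e φR) v ≡ v

module Submission where

open import Defs
open import Data.Product using (_×_; _,_)
open import Relation.Binary.PropositionalEquality using (sym; cong; module ≡-Reasoning)

induced⇒star : ∀ {D R S ER ES} (φS : SHom ES S) (αR : SScheme D R ER)
               (ρ : SScheme D R S) (ε : SHom ER ES) →
               InducedBy φS αR ρ ε → Star αR ρ
induced⇒star φS αR ρ ε induced G H dG dH ξ ζ v w αv≡αw = begin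
  map (ρ G dG ξ) v                        ≡⟨ induced G dG ξ v ⟩
  map φS (map ε (map (αR G dG ξ) v))      ≡⟨ cong (λ u → map φS (map ε u)) αv≡αw ⟩
  map φS (map ε (map (αR H dH ζ) w))      ≡⟨ sym (induced H dH ζ w) ⟩
  map (ρ H dH ζ) w                        ∎
  where open ≡-Reasoning

-- By AID, αR G ξ v = αR ER φR (αR G ξ v); so (∗) transports ρ G ξ v to
-- ρ ER φR evaluated at αR G ξ v, which φS ∘ αS recovers since αS is a section.
star⇒induced : ∀ {D R S ER ES} (φR : SHom ER R) (φS : SHom ES S)
               (αR : SScheme D R ER) (αS : SScheme D S ES) →
               IsSection φS αS → (ρ : SScheme D R S) (e : D ER) →
               AID φR αR e → Star αR ρ →
               InducedBy φS αR ρ (αS ER e (ρ ER e φR))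
star⇒induced {ER = ER} φR φS αR αS sectionS ρ e aid star G d ξ v = begin
  map (ρ G d ξ) v                      ≡⟨ star G ER d e ξ φR v u (sym (aid u)) ⟩
  map (ρ ER e φR) u                    ≡⟨ sym (sectionS ER e (ρ ER e φR) u) ⟩
  map φS (map (αS ER e (ρ ER e φR)) u) ∎
  where
  open ≡-Reasoning
  u : V ER
  u = map (αR G d ξ) v

theorem3 : (D : Class) (R S ER ES : Digraph)
    (φR : SHom ER R) (φS : SHom ES S)
    (αR : SScheme D R ER) (αS : SScheme D S ES) →
    IsSection φR αR → IsSection φS αS →
    (ρ : SScheme D R S) →
    ((ε : SHom ER ES) → InducedBy φS αR ρ ε → Star αR ρ)
    × ((e : D ER) → AID φR αR e → Star αR ρ →
       InducedBy φS αR ρ (αS ER e (ρ ER e φR)))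
theorem3 D R S ER ES φR φS αR αS _ sectionS ρ =
  induced⇒star φS αR ρ , star⇒induced φR φS αR αS sectionS ρ
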